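{- Let $\Lambda$ be a restorative similarity type and $\mathfrak{M}=\langle W,R,\{P_k\}_{k\in K}\rangle$ a Kripke model. For all $w,v\in W$: if $w\mathrel{\underline{\to}}_\Lambda v$ (i.e. there is a $\Lambda$-simulation $S$ on $\mathfrak{M}$ with $(w,v)\in S$), then $w\rightsquigarrow_\Lambda v$ (i.e. for every $\varphi\in\mathcal{L}_\Lambda$, $\mathfrak{M},w\Vdash\varphi$ implies $\mathfrak{M},v\Vdash\varphi$).
   Context: Fix a set $K$ of indices for propositional letters $p_k$ ($k\in K$). Consider six unary connectives $\smile,\frown,\circ_\smile,\circ_\frown,\bullet_\smile,\bullet_\frown$. A restorative similarity type is any subset $\Lambda\subseteq\{\smile,\frown,\circ_\smile,\circ_\frown,\bullet_\smile,\bullet_\frown\}$. The language $\mathcal{L}_\Lambda$ is generated by $\phi::=p_k\mid\top\mid\bot\mid\phi\wedge\phi\mid\phi\vee\phi\mid\star\phi$ with $k\in K$, $\star\in\Lambda$. A Kripke model is $\mathfrak{M}=\langle W,R,\{P_k\}_{k\in K}\rangle$ with $W$ a nonempty set, $R\subseteq W\times W$ and each $P_k\subseteq W$. Satisfaction: $w\Vdash p_k$ iff $w\in P_k$; $\top$ is true everywhere and $\bot$ nowhere; $\wedge,\vee$ classical; $w\Vdash\smile\phi$ iff some $v$ with $wRv$ has $v\not\Vdash\phi$; $w\Vdash\frown\phi$ iff every $v$ with $wRv$ has $v\not\Vdash\phi$; $w\Vdash\circ_\smile\phi$ iff $w\not\Vdash\phi$ or every $v$ with $wRv$ has $v\Vdash\phi$;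 $w\Vdash\circ_\frown\phi$ iff $w\Vdash\phi$ or every $v$ with $wRv$ has $v\not\Vdash\phi$; $w\Vdash\bullet_\smile\phi$ iff $w\Vdash\phi$ and some $v$ with $wRv$ has $v\not\Vdash\phi$; $w\Vdash\bullet_\frown\phi$ iff $w\not\Vdash\phi$ and some $v$ with $wRv$ has $v\Vdash\phi$. A relation $S\subseteq W\times W$ is a $\Lambda$-simulation on $\mathfrak{M}$ if it satisfies (Sim$_k$) for every $k\in K$ and (Sim$\star$) for every $\star\in\Lambda$, where (all quantified worlds range over $W$): (Sim$_k$) if $(w,v)\in S$ and $w\in P_k$ then $v\in P_k$; (Sim$\smile$) if $(w,v)\in S$ and $wRs$ then there is $t$ with $vRt$ and $(t,s)\in S$; (Sim$\frown$) if $(w,v)\in S$ and $vRt$ then there is $s$ with $wRs$ and $(t,s)\in S$; (Sim$\circ_\smile$) if $(w,v)\in S$ and $vRt$ then either $(v,t)\in S$, or both $(v,w)\in S$ and there is $s$ with $wRs$ and $(s,t)\in S$; (Sim$\circ_\frown$) if $(w,v)\in S$ and $vRt$ then either $(t,v)\in S$, or there is $s$ with $wRs$ and $(t,s)\in S$; (Sim$\bullet_\smile$) if $(w,v)\in S$ and $wRs$ then either $(w,s)\in S$, or there is $t$ with $vRt$ and $(t,s)\in S$; (Sim$\bullet_\frown$) if $(w,v)\in S$ and $wRs$ then either $(s,w)\in S$, or both $(v,w)\in S$ and there is $t$ with $vRt$ and $(s,t)\in S$. -}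

module Defs where

open import Level using (Level; _⊔_; suc)
open import Data.Product using (_×_; _,_; Σ; ∃)
open import Data.Sum using (_⊎_)
open import Data.Empty using (⊥)
open import Data.Unit using (⊤)
open import Data.Bool using (Bool; true)
open import Relation.Binary.PropositionalEquality using (_≡_)
open import Relation.Nullary using (¬_)

data Conn : Set where
  smile frown circSmile circFrown bulletSmile bulletFrown : Conn

SimType : Set₁
SimType = Conn → Set

data Fm (K : Set) (Λ : SimType) : Set where
  var   : K → Fm K Λ
  ⊤'    : Fm K Λ
  ⊥'    : Fm K Λ
  _∧'_  : Fm K Λ → Fm K Λ → Fm K Λ
  _∨'_  : Fm K Λ → Fm K Λ → Fm K Λ
  op    : (c : Conn) → Λ c → Fm K Λ → Fm K Λ

record Model (K : Set) : Set₁ where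
  field
    W     : Set
    inhab : W
    R     : W → W → Set
    -- P k w ≡ true  iff  w ∈ P_k  (valuations are subsets, given as characteristic functions)
    P     : K → W → Bool

-- Classical connectives in the meta-language (Gödel–Gentzen style):
-- "A or B" and "there exists" read classically.
_∨c_ : Set → Set → Set
A ∨c B = ¬ (¬ A × ¬ B)

module _ {K : Set} (M : Model K) where
  open Model M

  Some : W → (W → Set) → Set
  Some w Q = ¬ (∀ v → R w v → ¬ Q v)

  Every : W → (W → Set) → Set
  Every w Q = ∀ v → R w v → Q v

  infix 4 _⊩_
  _⊩_ : {Λ : SimType} → W → Fm K Λ → Set
  w ⊩ var k                 = P k w ≡ true
  w ⊩ ⊤'                    = ⊤
  w ⊩ ⊥'                    = ⊥
  w ⊩ (φ ∧' ψ)              = (w ⊩ φ) × (w ⊩ ψ)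
  w ⊩ (φ ∨' ψ)              = (w ⊩ φ) ∨c (w ⊩ ψ)
  w ⊩ op smile _ φ          = Some w (λ v → ¬ (v ⊩ φ))
  w ⊩ op frown _ φ          = Every w (λ v → ¬ (v ⊩ φ))
  w ⊩ op circSmile _ φ      = (¬ (w ⊩ φ)) ∨c Every w (λ v → v ⊩ φ)
  w ⊩ op circFrown _ φ      = (w ⊩ φ) ∨c Every w (λ v → ¬ (v ⊩ φ))
  w ⊩ op bulletSmile _ φ    = (w ⊩ φ) × Some w (λ v → ¬ (v ⊩ φ))
  w ⊩ op bulletFrown _ φ    = (¬ (w ⊩ φ)) × Some w (λ v → v ⊩ φ)

  SimClause : (W → W → Set) → Conn → Set
  SimClause S smile = ∀ w v s → S w v → R w s → ∃ λ t → R v t × S t s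
  SimClause S frown = ∀ w v t → S w v → R v t → ∃ λ s → R w s × S t s
  SimClause S circSmile = ∀ w v t → S w v → R v t →
    S v t ⊎ (S v w × ∃ λ s → R w s × S s t)
  SimClause S circFrown = ∀ w v t → S w v → R v t →
    S t v ⊎ (∃ λ s → R w s × S t s)
  SimClause S bulletSmile = ∀ w v s → S w v → R w s →
    S w s ⊎ (∃ λ t → R v t × S t s)
  SimClause S bulletFrown = ∀ w v s → S w v → R w s →
    S s w ⊎ (S v w × ∃ λ t → R v t × S s t)

  record IsSimulation (Λ : SimType) (S : W → W → Set) : Set where
    field
      simProp : ∀ k w v → S w v → P k w ≡ true → P k v ≡ true
      simConn : ∀ c → Λ c → SimClause S c

  Simulates : SimType → W → W → Set₁
  Simulates Λ w v = Σ (W → W → Set) λ S → IsSimulation Λ S × S w v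

  Preserves : SimType → W → W → Set
  Preserves Λ w v = ∀ (φ : Fm K Λ) → w ⊩ φ → v ⊩ φ

{-# OPTIONS --safe #-}
-- Induction on formulas: the truth set of each formula is closed forward along
-- any Λ-simulation S, each connective's clause (Sim⋆) being exactly what makes
-- the corresponding step go through.  The clause for ∘⌣ only yields a
-- contradiction from a failure of φ at a successor, so that step needs truth
-- sets to be ¬¬-stable; they are, since letters are Boolean-valued and "or" and
-- "some" are read classically.
module Submission where

open import Defs
open import Data.Bool using (true)
open import Data.Bool.Properties using (_≟_)
open import Data.Product using (_×_; _,_; proj₁; proj₂)
import Data.Product as Product
open import Data.Sum using (inj₁; inj₂)
open import Data.Unit using (tt)
open import Function using (_∘_; id; const; case_of_)
open import Relation.Nullary using (¬_)
open import Relation.Nullary.Decidable using (decidable-stable)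
open import Relation.Nullary.Negation using (Stable; negated-stable; ¬¬-map)

×-stable : {A B : Set} → Stable A → Stable B → Stable (A × B)
×-stable A-stable B-stable ¬¬ab = A-stable (¬¬-map proj₁ ¬¬ab) , B-stable (¬¬-map proj₂ ¬¬ab)

module _ {K : Set} (M : Model K) where
  open Model M

  ⟦_⟧ : {Λ : SimType} → Fm K Λ → W → Set
  ⟦ φ ⟧ w = _⊩_ M w φ

  ⊩-stable : {Λ : SimType} (φ : Fm K Λ) (w : W) → Stable (⟦ φ ⟧ w)
  ⊩-stable (var k)               w = decidable-stable (P k w ≟ true)
  ⊩-stable ⊤'                    w = const tt
  ⊩-stable ⊥'                    w = λ ¬¬⊥ → ¬¬⊥ id
  ⊩-stable (φ ∧' ψ)              w = ×-stable (⊩-stable φ w) (⊩-stable ψ w)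
  ⊩-stable (φ ∨' ψ)              w = negated-stable
  ⊩-stable (op smile _ φ)        w = negated-stable
  ⊩-stable (op frown _ φ)        w = λ ¬¬all v wRv → negated-stable (¬¬-map (λ all → all v wRv) ¬¬all)
  ⊩-stable (op circSmile _ φ)    w = negated-stable
  ⊩-stable (op circFrown _ φ)    w = negated-stable
  ⊩-stable (op bulletSmile _ φ)  w = ×-stable (⊩-stable φ w) negated-stable
  ⊩-stable (op bulletFrown _ φ)  w = ×-stable negated-stable negated-stable

  module _ (S : W → W → Set) where

    ClosedAlong : (W → Set) → Set
    ClosedAlong Q = ∀ {a b} → S a b → Q a → Q b

    module _ {Q : W → Set} (Q-closed : ClosedAlong Q) where

      smile-closed : SimClause M S smile →
                     ClosedAlong (λ w → Some M w (¬_ ∘ Q))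
      smile-closed sim {a} {b} Sab some¬Qa all¬¬Qb =
        some¬Qa λ s aRs ¬Qs →
          let (t , bRt , Sts) = sim a b s Sab aRs
          in all¬¬Qb t bRt (¬Qs ∘ Q-closed Sts)

      frown-closed : SimClause M S frown →
                     ClosedAlong (λ w → Every M w (¬_ ∘ Q))
      frown-closed sim {a} {b} Sab all¬Qa t bRt Qt =
        let (s , aRs , Sts) = sim a b t Sab bRt
        in all¬Qa s aRs (Q-closed Sts Qt)

      circSmile-closed : (∀ w → Stable (Q w)) → SimClause M S circSmile →
                         ClosedAlong (λ w → (¬ Q w) ∨c Every M w Q)
      circSmile-closed Q-stable sim {a} {b} Sab holds-a (¬¬Qb , ¬allQb) =
        ¬¬Qb λ Qb → ¬allQb λ t bRt → Q-stable t λ ¬Qt →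
          case sim a b t Sab bRt of λ where
            (inj₁ Sbt) → ¬Qt (Q-closed Sbt Qb)
            (inj₂ (Sba , s , aRs , Sst)) →
              holds-a ((λ ¬Qa → ¬Qa (Q-closed Sba Qb)) , λ allQa → ¬Qt (Q-closed Sst (allQa s aRs)))

      circFrown-closed : SimClause M S circFrown →
                         ClosedAlong (λ w → Q w ∨c Every M w (¬_ ∘ Q))
      circFrown-closed sim {a} {b} Sab holds-a (¬Qb , ¬all¬Qb) =
        ¬all¬Qb λ t bRt Qt →
          case sim a b t Sab bRt of λ where
            (inj₁ Stb) → ¬Qb (Q-closed Stb Qt)
            (inj₂ (s , aRs , Sts)) →
              holds-a (¬Qb ∘ Q-closed Sab , λ all¬Qa → all¬Qa s aRs (Q-closed Sts Qt))

      bulletSmile-closed : SimClause M S bulletSmile →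
                           ClosedAlong (λ w → Q w × Some M w (¬_ ∘ Q))
      bulletSmile-closed sim {a} {b} Sab (Qa , some¬Qa) =
        Q-closed Sab Qa , λ all¬¬Qb → some¬Qa λ s aRs ¬Qs →
          case sim a b s Sab aRs of λ where
            (inj₁ Sas) → ¬Qs (Q-closed Sas Qa)
            (inj₂ (t , bRt , Sts)) → all¬¬Qb t bRt (¬Qs ∘ Q-closed Sts)

      bulletFrown-closed : SimClause M S bulletFrown →
                           ClosedAlong (λ w → (¬ Q w) × Some M w Q)
      bulletFrown-closed sim {a} {b} Sab (¬Qa , someQa) =
        (λ Qb → someQa λ s aRs Qs →
          case sim a b s Sab aRs of λ where
            (inj₁ Ssa) → ¬Qa (Q-closed Ssa Qs)
            (inj₂ (Sba , _)) → ¬Qa (Q-closed Sba Qb)) ,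
        (λ all¬Qb → someQa λ s aRs Qs →
          case sim a b s Sab aRs of λ where
            (inj₁ Ssa) → ¬Qa (Q-closed Ssa Qs)
            (inj₂ (_ , t , bRt , Sst)) → all¬Qb t bRt (Q-closed Sst Qs))

    module _ {Λ : SimType} (S-sim : IsSimulation M Λ S) where
      open IsSimulation S-sim

      ⊩-closed : (φ : Fm K Λ) → ClosedAlong ⟦ φ ⟧
      ⊩-closed (var k)              {a} {b} = simProp k a b
      ⊩-closed ⊤'                   _ = id
      ⊩-closed ⊥'                   _ = id
      ⊩-closed (φ ∧' ψ)             Sab = Product.map (⊩-closed φ Sab) (⊩-closed ψ Sab)
      ⊩-closed (φ ∨' ψ)             Sab holds-a (¬φb , ¬ψb) =
        holds-a (¬φb ∘ ⊩-closed φ Sab , ¬ψb ∘ ⊩-closed ψ Sab)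
      ⊩-closed (op smile l φ)       = smile-closed (⊩-closed φ) (simConn smile l)
      ⊩-closed (op frown l φ)       = frown-closed (⊩-closed φ) (simConn frown l)
      ⊩-closed (op circSmile l φ)   = circSmile-closed (⊩-closed φ) (⊩-stable φ) (simConn circSmile l)
      ⊩-closed (op circFrown l φ)   = circFrown-closed (⊩-closed φ) (simConn circFrown l)
      ⊩-closed (op bulletSmile l φ) = bulletSmile-closed (⊩-closed φ) (simConn bulletSmile l)
      ⊩-closed (op bulletFrown l φ) = bulletFrown-closed (⊩-closed φ) (simConn bulletFrown l)

theorem4p3 : (K : Set) (Λ : SimType) (M : Model K) (w v : Model.W M) →
    Simulates M Λ w v → Preserves M Λ w v
theorem4p3 K Λ M w v (S , S-sim , Swv) φ = ⊩-closed M S S-sim φ Swv
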